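{- Every Kleene bicategory $\mathcal{C}$ is a typed Kleene algebra, with join given by the convolution $f+g:=\Delta_X;(f\oplus g);\nabla_Y$, bottom $!_X;¡_Y$, and Kleene star $f^*:=\mathsf{tr}_X\big(\nabla_X;\Delta_X;(f\oplus\mathrm{id}_X)\big)$ for $f\colon X\to X$.
   Context: Composition is diagrammatic. A finite biproduct category with idempotent convolution is a poset-enriched symmetric monoidal category $(\mathcal{C},\oplus,0)$ where every $X$ has a commutative monoid $(\nabla_X\colon X\oplus X\to X,¡_X\colon0\to X)$ and cocommutative comonoid $(\Delta_X\colon X\to X\oplus X,!_X\colon X\to0)$, coherent with $\oplus$, with every morphism a monoid and comonoid homomorphism, and with $\mathrm{id}_{X\oplus X}\le\nabla_X;\Delta_X$, $\Delta_X;\nabla_X\le\mathrm{id}_X$, $\mathrm{id}_0\le¡_X;!_X$, $!_X;¡_X\le\mathrm{id}_X$. A Kleene bicategory is such a category with a trace $\mathsf{tr}_S\colon\mathcal{C}(S\oplus X,S\oplus Y)\to\mathcal{C}(X,Y)$ (tightening, strength, joining, vanishing, sliding, yanking) satisfying: (AU1) if $f;(r\oplus\mathrm{id}_Y)\le(r\oplus\mathrm{id}_X);g$ for some $r\colon S\to T$ then $\mathsf{tr}_Sf\le\mathsf{tr}_Tg$; (AU2) if $(r\oplus\mathrm{id}_X);f\le g;(r\oplus\mathrm{id}_Y)$ for some $r\colon T\to S$ then $\mathsf{tr}_Sf\le\mathsf{tr}_Tg$ (for $f\colon S\oplus X\to S\oplus Y$, $g\colon T\oplus X\to T\oplus Y$);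 (AT1) $\mathsf{tr}_X(\nabla_X;\Delta_X)\le\mathrm{id}_X$. Here the trace is taken over the first summand. A typed Kleene algebra is a category whose homsets are join-semilattices with bottom, composition preserving finite joins in each argument, equipped with operations $(\cdot)^*\colon\mathcal{C}(X,X)\to\mathcal{C}(X,X)$ such that $\mathrm{id}+f;f^*\le f^*$, $\mathrm{id}+f^*;f\le f^*$, $f;r\le r\Rightarrow f^*;r\le r$, and $l;f\le l\Rightarrow l;f^*\le l$. -}

module Defs where

open import Level using (Level; _⊔_; suc)
open import Relation.Binary.PropositionalEquality using (_≡_)
open import Algebra.Structures using (IsIdempotentCommutativeMonoid)

-- Composition is diagrammatic: f ⨾ g means "f then g".

record SymMonPosetCat (o ℓ e : Level) : Set (suc (o ⊔ ℓ ⊔ e)) where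
  infixr 9 _⨾_
  infixr 10 _⊕_ _⊕₁_
  infix 4 _≤_
  field
    Obj  : Set o
    Hom  : Obj → Obj → Set ℓ
    id   : ∀ {X} → Hom X X
    _⨾_  : ∀ {X Y Z} → Hom X Y → Hom Y Z → Hom X Z
    ⨾-assoc : ∀ {W X Y Z} (f : Hom W X) (g : Hom X Y) (h : Hom Y Z) →
              (f ⨾ g) ⨾ h ≡ f ⨾ (g ⨾ h)
    ⨾-idˡ : ∀ {X Y} (f : Hom X Y) → id ⨾ f ≡ f
    ⨾-idʳ : ∀ {X Y} (f : Hom X Y) → f ⨾ id ≡ f

    _≤_      : ∀ {X Y} → Hom X Y → Hom X Y → Set e
    ≤-refl   : ∀ {X Y} {f : Hom X Y} → f ≤ f
    ≤-trans  : ∀ {X Y} {f g h : Hom X Y} → f ≤ g → g ≤ h → f ≤ h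
    ≤-antisym : ∀ {X Y} {f g : Hom X Y} → f ≤ g → g ≤ f → f ≡ g
    ⨾-mono   : ∀ {X Y Z} {f f′ : Hom X Y} {g g′ : Hom Y Z} →
               f ≤ f′ → g ≤ g′ → f ⨾ g ≤ f′ ⨾ g′

    _⊕_  : Obj → Obj → Obj
    𝟘    : Obj
    _⊕₁_ : ∀ {X Y X′ Y′} → Hom X Y → Hom X′ Y′ → Hom (X ⊕ X′) (Y ⊕ Y′)
    ⊕-id : ∀ {X Y} → id {X} ⊕₁ id {Y} ≡ id
    ⊕-⨾  : ∀ {X Y Z X′ Y′ Z′} (f : Hom X Y) (g : Hom Y Z)
             (f′ : Hom X′ Y′) (g′ : Hom Y′ Z′) →
           (f ⨾ g) ⊕₁ (f′ ⨾ g′) ≡ (f ⊕₁ f′) ⨾ (g ⊕₁ g′)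
    ⊕-mono : ∀ {X Y X′ Y′} {f g : Hom X Y} {f′ g′ : Hom X′ Y′} →
             f ≤ g → f′ ≤ g′ → f ⊕₁ f′ ≤ g ⊕₁ g′

    α    : ∀ {X Y Z} → Hom ((X ⊕ Y) ⊕ Z) (X ⊕ (Y ⊕ Z))
    α⁻¹  : ∀ {X Y Z} → Hom (X ⊕ (Y ⊕ Z)) ((X ⊕ Y) ⊕ Z)
    α-iso₁ : ∀ {X Y Z} → α {X} {Y} {Z} ⨾ α⁻¹ ≡ id
    α-iso₂ : ∀ {X Y Z} → α⁻¹ {X} {Y} {Z} ⨾ α ≡ id
    α-nat  : ∀ {X Y Z X′ Y′ Z′} (f : Hom X X′) (g : Hom Y Y′) (h : Hom Z Z′) →
             ((f ⊕₁ g) ⊕₁ h) ⨾ α ≡ α ⨾ (f ⊕₁ (g ⊕₁ h))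

    lu    : ∀ {X} → Hom (𝟘 ⊕ X) X
    lu⁻¹  : ∀ {X} → Hom X (𝟘 ⊕ X)
    lu-iso₁ : ∀ {X} → lu {X} ⨾ lu⁻¹ ≡ id
    lu-iso₂ : ∀ {X} → lu⁻¹ {X} ⨾ lu ≡ id
    lu-nat  : ∀ {X Y} (f : Hom X Y) → (id ⊕₁ f) ⨾ lu ≡ lu ⨾ f

    ru    : ∀ {X} → Hom (X ⊕ 𝟘) X
    ru⁻¹  : ∀ {X} → Hom X (X ⊕ 𝟘)
    ru-iso₁ : ∀ {X} → ru {X} ⨾ ru⁻¹ ≡ id
    ru-iso₂ : ∀ {X} → ru⁻¹ {X} ⨾ ru ≡ id
    ru-nat  : ∀ {X Y} (f : Hom X Y) → (f ⊕₁ id) ⨾ ru ≡ ru ⨾ f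

    σ     : ∀ {X Y} → Hom (X ⊕ Y) (Y ⊕ X)
    σ-nat : ∀ {X Y X′ Y′} (f : Hom X X′) (g : Hom Y Y′) →
            (f ⊕₁ g) ⨾ σ ≡ σ ⨾ (g ⊕₁ f)
    σ-inv : ∀ {X Y} → σ {X} {Y} ⨾ σ ≡ id

    pentagon : ∀ {W X Y Z} →
      (α {W} {X} {Y} ⊕₁ id {Z}) ⨾ α ⨾ (id ⊕₁ α) ≡ α ⨾ α
    triangle : ∀ {X Y} → α {X} {𝟘} {Y} ⨾ (id ⊕₁ lu) ≡ ru ⊕₁ id
    hexagon  : ∀ {X Y Z} →
      α {X} {Y} {Z} ⨾ σ ⨾ α ≡ (σ ⊕₁ id) ⨾ α ⨾ (id ⊕₁ σ)

module Interchange {o ℓ e} (C : SymMonPosetCat o ℓ e) where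
  open SymMonPosetCat C
  ex : ∀ {A B C′ D} → Hom ((A ⊕ B) ⊕ (C′ ⊕ D)) ((A ⊕ C′) ⊕ (B ⊕ D))
  ex = α ⨾ (id ⊕₁ (α⁻¹ ⨾ (σ ⊕₁ id) ⨾ α)) ⨾ α⁻¹

record IsFBCIC {o ℓ e} (C : SymMonPosetCat o ℓ e) : Set (o ⊔ ℓ ⊔ e) where
  open SymMonPosetCat C
  open Interchange C
  field
    ∇ : ∀ X → Hom (X ⊕ X) X
    ¡ : ∀ X → Hom 𝟘 X
    Δ : ∀ X → Hom X (X ⊕ X)
    ! : ∀ X → Hom X 𝟘

    ∇-assoc : ∀ X → (∇ X ⊕₁ id) ⨾ ∇ X ≡ α ⨾ (id ⊕₁ ∇ X) ⨾ ∇ X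
    ∇-unitˡ : ∀ X → (¡ X ⊕₁ id) ⨾ ∇ X ≡ lu
    ∇-unitʳ : ∀ X → (id ⊕₁ ¡ X) ⨾ ∇ X ≡ ru
    ∇-comm  : ∀ X → σ ⨾ ∇ X ≡ ∇ X

    Δ-coassoc : ∀ X → Δ X ⨾ (Δ X ⊕₁ id) ⨾ α ≡ Δ X ⨾ (id ⊕₁ Δ X)
    Δ-counitˡ : ∀ X → Δ X ⨾ (! X ⊕₁ id) ≡ lu⁻¹
    Δ-counitʳ : ∀ X → Δ X ⨾ (id ⊕₁ ! X) ≡ ru⁻¹
    Δ-cocomm  : ∀ X → Δ X ⨾ σ ≡ Δ X

    ∇-⊕ : ∀ X Y → ∇ (X ⊕ Y) ≡ ex ⨾ (∇ X ⊕₁ ∇ Y)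
    ¡-⊕ : ∀ X Y → ¡ (X ⊕ Y) ≡ lu⁻¹ ⨾ (¡ X ⊕₁ ¡ Y)
    Δ-⊕ : ∀ X Y → Δ (X ⊕ Y) ≡ (Δ X ⊕₁ Δ Y) ⨾ ex
    !-⊕ : ∀ X Y → ! (X ⊕ Y) ≡ (! X ⊕₁ ! Y) ⨾ lu
    ∇-𝟘 : ∇ 𝟘 ≡ lu
    ¡-𝟘 : ¡ 𝟘 ≡ id
    Δ-𝟘 : Δ 𝟘 ≡ lu⁻¹
    !-𝟘 : ! 𝟘 ≡ id

    ∇-hom : ∀ {X Y} (f : Hom X Y) → ∇ X ⨾ f ≡ (f ⊕₁ f) ⨾ ∇ Y
    ¡-hom : ∀ {X Y} (f : Hom X Y) → ¡ X ⨾ f ≡ ¡ Y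
    Δ-hom : ∀ {X Y} (f : Hom X Y) → f ⨾ Δ Y ≡ Δ X ⨾ (f ⊕₁ f)
    !-hom : ∀ {X Y} (f : Hom X Y) → f ⨾ ! Y ≡ ! X

    id≤∇Δ : ∀ X → id {X ⊕ X} ≤ ∇ X ⨾ Δ X
    Δ∇≤id : ∀ X → Δ X ⨾ ∇ X ≤ id
    id≤¡! : ∀ X → id {𝟘} ≤ ¡ X ⨾ ! X
    !¡≤id : ∀ X → ! X ⨾ ¡ X ≤ id

record IsKleeneBicategory {o ℓ e} (C : SymMonPosetCat o ℓ e)
                          (B : IsFBCIC C) : Set (o ⊔ ℓ ⊔ e) where
  open SymMonPosetCat C
  open IsFBCIC B
  field
    tr : ∀ {S X Y} → Hom (S ⊕ X) (S ⊕ Y) → Hom X Y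

    tightening : ∀ {S X X′ Y Y′} (f : Hom X′ X) (h : Hom (S ⊕ X) (S ⊕ Y))
                   (g : Hom Y Y′) →
                 tr ((id ⊕₁ f) ⨾ h ⨾ (id ⊕₁ g)) ≡ f ⨾ tr h ⨾ g
    strength   : ∀ {S X Y Z W} (h : Hom (S ⊕ X) (S ⊕ Y)) (g : Hom Z W) →
                 tr {S} (α⁻¹ ⨾ (h ⊕₁ g) ⨾ α) ≡ tr h ⊕₁ g
    joining    : ∀ {T S X Y} (h : Hom (T ⊕ (S ⊕ X)) (T ⊕ (S ⊕ Y))) →
                 tr {S} (tr {T} h) ≡ tr {T ⊕ S} (α ⨾ h ⨾ α⁻¹)
    vanishing  : ∀ {X Y} (h : Hom (𝟘 ⊕ X) (𝟘 ⊕ Y)) →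
                 tr {𝟘} h ≡ lu⁻¹ ⨾ h ⨾ lu
    sliding    : ∀ {S T X Y} (f : Hom (S ⊕ X) (T ⊕ Y)) (g : Hom T S) →
                 tr {S} (f ⨾ (g ⊕₁ id)) ≡ tr {T} ((g ⊕₁ id) ⨾ f)
    yanking    : ∀ {X} → tr {X} (σ {X} {X}) ≡ id

    AU1 : ∀ {S T X Y} (f : Hom (S ⊕ X) (S ⊕ Y)) (g : Hom (T ⊕ X) (T ⊕ Y))
            (r : Hom S T) →
          f ⨾ (r ⊕₁ id) ≤ (r ⊕₁ id) ⨾ g → tr f ≤ tr g
    AU2 : ∀ {S T X Y} (f : Hom (S ⊕ X) (S ⊕ Y)) (g : Hom (T ⊕ X) (T ⊕ Y))
            (r : Hom T S) →
          (r ⊕₁ id) ⨾ f ≤ g ⨾ (r ⊕₁ id) → tr f ≤ tr g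
    AT1 : ∀ X → tr {X} (∇ X ⨾ Δ X) ≤ id

record KleeneBicategory (o ℓ e : Level) : Set (suc (o ⊔ ℓ ⊔ e)) where
  field
    cat  : SymMonPosetCat o ℓ e
    fbc  : IsFBCIC cat
    isKB : IsKleeneBicategory cat fbc
  open SymMonPosetCat cat public
  open IsFBCIC fbc public
  open IsKleeneBicategory isKB public

  _+_ : ∀ {X Y} → Hom X Y → Hom X Y → Hom X Y
  _+_ {X} {Y} f g = Δ X ⨾ (f ⊕₁ g) ⨾ ∇ Y

  ⊥ : ∀ {X Y} → Hom X Y
  ⊥ {X} {Y} = ! X ⨾ ¡ Y

  _* : ∀ {X} → Hom X X → Hom X X
  _* {X} f = tr {X} (∇ X ⨾ Δ X ⨾ (f ⊕₁ id))

record IsTypedKleeneAlgebra {o ℓ} {Obj : Set o} (Hom : Obj → Obj → Set ℓ)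
    (id : ∀ {X} → Hom X X)
    (_⨾_ : ∀ {X Y Z} → Hom X Y → Hom Y Z → Hom X Z)
    (_+_ : ∀ {X Y} → Hom X Y → Hom X Y → Hom X Y)
    (0# : ∀ {X Y} → Hom X Y)
    (_* : ∀ {X} → Hom X X → Hom X X) : Set (o ⊔ ℓ) where
  _⊑_ : ∀ {X Y} → Hom X Y → Hom X Y → Set ℓ
  f ⊑ g = f + g ≡ g
  field
    joinSemilattice : ∀ {X Y} →
      IsIdempotentCommutativeMonoid (_≡_ {A = Hom X Y}) _+_ 0#
    ⨾-distribˡ-+ : ∀ {X Y Z} (f : Hom X Y) (g h : Hom Y Z) →
                   f ⨾ (g + h) ≡ (f ⨾ g) + (f ⨾ h)
    ⨾-distribʳ-+ : ∀ {X Y Z} (f g : Hom X Y) (h : Hom Y Z) →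
                   (f + g) ⨾ h ≡ (f ⨾ h) + (g ⨾ h)
    ⨾-zeroˡ : ∀ {X Y Z} (f : Hom Y Z) → 0# {X} ⨾ f ≡ 0#
    ⨾-zeroʳ : ∀ {X Y Z} (f : Hom X Y) → f ⨾ 0# {Y} {Z} ≡ 0#
    star-unfoldˡ : ∀ {X} (f : Hom X X) → (id + (f ⨾ (f *))) ⊑ (f *)
    star-unfoldʳ : ∀ {X} (f : Hom X X) → (id + ((f *) ⨾ f)) ⊑ (f *)
    star-indˡ : ∀ {X Y} (f : Hom X X) (r : Hom X Y) →
                (f ⨾ r) ⊑ r → ((f *) ⨾ r) ⊑ r
    star-indʳ : ∀ {X Y} (f : Hom Y Y) (l : Hom X Y) →
                (l ⨾ f) ⊑ l → (l ⨾ (f *)) ⊑ l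

{-# OPTIONS --safe #-}

-- The convolution order coincides with the enrichment order: ⊥ ≤ f and f + f ≤ f come from
-- !¡ ≤ id and Δ∇ ≤ id, and f + ⊥ = f is a (co)unit law, so + is the binary join and each homset
-- is a join-semilattice with bottom; composition distributes over it because every morphism is
-- a monoid and comonoid homomorphism. For f * = tr (∇ ⨾ Δ ⨾ (f ⊕₁ id)), the induction laws are
-- uniformity (AU1 along r, AU2 along l) followed by AT1, id ≤ f * is uniformity along ¡ starting
-- from the vanishing trace, and f ⨾ f * = f * ⨾ f is sliding. The unfolding f ⨾ f * ≤ f * needs a
-- one-step delay: by yanking, f ⨾ f * is a double trace, joining turns it into a single trace
-- over X ⊕ X, and uniformity along ∇ compares that trace with f *.

module Submission where

open import Defs
open import Data.Product using (_,_)
open import Relation.Binary.PropositionalEquality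
  using (_≡_; refl; sym; trans; cong; cong₂; isEquivalence; module ≡-Reasoning)
open import Relation.Binary.Bundles using (Poset)
open import Algebra.Structures using (IsIdempotentCommutativeMonoid)
import Relation.Binary.Reasoning.PartialOrder as PosetReasoning

module Monoidal {o ℓ e} (C : SymMonPosetCat o ℓ e) where
  open SymMonPosetCat C

  homPoset : Obj → Obj → Poset ℓ ℓ e
  homPoset X Y = record
    { Carrier = Hom X Y
    ; _≈_ = _≡_
    ; _≤_ = _≤_
    ; isPartialOrder = record
      { isPreorder = record
        { isEquivalence = isEquivalence
        ; reflexive = λ { refl → ≤-refl }
        ; trans = ≤-trans
        }
      ; antisym = ≤-antisym
      }
    }

  module ≤-Reasoning {X Y : Obj} = PosetReasoning (homPoset X Y)

  ≤-reflexive : ∀ {X Y} {f g : Hom X Y} → f ≡ g → f ≤ g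
  ≤-reflexive refl = ≤-refl

  ⨾-monoˡ : ∀ {X Y Z} {f f′ : Hom X Y} {g : Hom Y Z} → f ≤ f′ → f ⨾ g ≤ f′ ⨾ g
  ⨾-monoˡ p = ⨾-mono p ≤-refl

  ⨾-monoʳ : ∀ {X Y Z} {f : Hom X Y} {g g′ : Hom Y Z} → g ≤ g′ → f ⨾ g ≤ f ⨾ g′
  ⨾-monoʳ p = ⨾-mono ≤-refl p

  assoc³ : ∀ {A B C D E} (a : Hom A B) (b : Hom B C) (c : Hom C D) (u : Hom D E) →
           (a ⨾ b ⨾ c) ⨾ u ≡ a ⨾ b ⨾ c ⨾ u
  assoc³ a b c u = trans (⨾-assoc a (b ⨾ c) u) (cong (a ⨾_) (⨾-assoc b c u))

  pullˡ : ∀ {A B C D} {a : Hom A B} {b : Hom B C} {c : Hom A C} →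
          a ⨾ b ≡ c → (u : Hom C D) → a ⨾ b ⨾ u ≡ c ⨾ u
  pullˡ {a = a} {b} p u = trans (sym (⨾-assoc a b u)) (cong (_⨾ u) p)

  extend₂ : ∀ {A B B′ C D} {a : Hom A B} {b : Hom B C} {a′ : Hom A B′} {b′ : Hom B′ C} →
            a ⨾ b ≡ a′ ⨾ b′ → (u : Hom C D) → a ⨾ b ⨾ u ≡ a′ ⨾ b′ ⨾ u
  extend₂ p u = trans (pullˡ p u) (⨾-assoc _ _ u)

  cancelˡ : ∀ {A B C} {a : Hom A B} {b : Hom B A} → a ⨾ b ≡ id →
            (u : Hom A C) → a ⨾ b ⨾ u ≡ u
  cancelˡ p u = trans (pullˡ p u) (⨾-idˡ u)

  pushˡ : ∀ {A B C D} {a : Hom A C} {b : Hom A B} {c : Hom B C} →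
          a ≡ b ⨾ c → (u : Hom C D) → a ⨾ u ≡ b ⨾ c ⨾ u
  pushˡ p u = sym (pullˡ (sym p) u)

  pull₃ : ∀ {A B C D E} {a : Hom A B} {b : Hom B C} {c : Hom C D} {d : Hom A D} →
          a ⨾ b ⨾ c ≡ d → (u : Hom D E) → a ⨾ b ⨾ c ⨾ u ≡ d ⨾ u
  pull₃ p u = trans (sym (assoc³ _ _ _ u)) (cong (_⨾ u) p)

  extend₃ : ∀ {A B C D B′ C′ E} {a : Hom A B} {b : Hom B C} {c : Hom C D}
              {a′ : Hom A B′} {b′ : Hom B′ C′} {c′ : Hom C′ D} →
            a ⨾ b ⨾ c ≡ a′ ⨾ b′ ⨾ c′ → (u : Hom D E) → a ⨾ b ⨾ c ⨾ u ≡ a′ ⨾ b′ ⨾ c′ ⨾ u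
  extend₃ p u = trans (pull₃ p u) (assoc³ _ _ _ u)

  ⨾-idˡ′ : ∀ {X Y A B} (f : Hom (X ⊕ Y) (A ⊕ B)) → (id ⊕₁ id) ⨾ f ≡ f
  ⨾-idˡ′ f = trans (cong (_⨾ f) ⊕-id) (⨾-idˡ f)

  ⨾-idʳ′ : ∀ {X Y A B} (f : Hom (X ⊕ Y) (A ⊕ B)) → f ⨾ (id ⊕₁ id) ≡ f
  ⨾-idʳ′ f = trans (cong (f ⨾_) ⊕-id) (⨾-idʳ f)

  ⊕-interchange : ∀ {X Y Z X′ Y′ Z′} (f : Hom X Y) (f′ : Hom X′ Y′)
                    (g : Hom Y Z) (g′ : Hom Y′ Z′) →
                  (f ⊕₁ f′) ⨾ (g ⊕₁ g′) ≡ (f ⨾ g) ⊕₁ (f′ ⨾ g′)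
  ⊕-interchange f f′ g g′ = sym (⊕-⨾ f g f′ g′)

  serialize₁₂ : ∀ {X Y X′ Y′} (f : Hom X Y) (g : Hom X′ Y′) →
                f ⊕₁ g ≡ (f ⊕₁ id) ⨾ (id ⊕₁ g)
  serialize₁₂ f g = trans (cong₂ _⊕₁_ (sym (⨾-idʳ f)) (sym (⨾-idˡ g))) (⊕-⨾ f id id g)

  serialize₂₁ : ∀ {X Y X′ Y′} (f : Hom X Y) (g : Hom X′ Y′) →
                f ⊕₁ g ≡ (id ⊕₁ g) ⨾ (f ⊕₁ id)
  serialize₂₁ f g = trans (cong₂ _⊕₁_ (sym (⨾-idˡ f)) (sym (⨾-idʳ g))) (⊕-⨾ id f g id)

  ⊕-⨾ʳ : ∀ {X Y A B C} (f : Hom X Y) (a : Hom A B) (b : Hom B C) →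
         f ⊕₁ (a ⨾ b) ≡ (id ⊕₁ a) ⨾ (f ⊕₁ b)
  ⊕-⨾ʳ f a b = trans (cong (_⊕₁ (a ⨾ b)) (sym (⨾-idˡ f))) (⊕-⨾ id f a b)

  ⊕-inverse : ∀ {A B C D} {a : Hom A B} {a′ : Hom B A} {b : Hom C D} {b′ : Hom D C} →
              a ⨾ a′ ≡ id → b ⨾ b′ ≡ id → (a ⊕₁ b) ⨾ (a′ ⊕₁ b′) ≡ id
  ⊕-inverse {a = a} {a′} {b} {b′} p q =
    trans (⊕-interchange a b a′ b′) (trans (cong₂ _⊕₁_ p q) ⊕-id)

  α⁻¹-nat : ∀ {X Y Z X′ Y′ Z′} (f : Hom X X′) (g : Hom Y Y′) (h : Hom Z Z′) →
            (f ⊕₁ (g ⊕₁ h)) ⨾ α⁻¹ ≡ α⁻¹ ⨾ ((f ⊕₁ g) ⊕₁ h)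
  α⁻¹-nat f g h = begin
    (f ⊕₁ (g ⊕₁ h)) ⨾ α⁻¹              ≡⟨ sym (cancelˡ α-iso₂ _) ⟩
    α⁻¹ ⨾ α ⨾ (f ⊕₁ (g ⊕₁ h)) ⨾ α⁻¹    ≡⟨ cong (α⁻¹ ⨾_) (pullˡ (sym (α-nat f g h)) α⁻¹) ⟩
    α⁻¹ ⨾ (((f ⊕₁ g) ⊕₁ h) ⨾ α) ⨾ α⁻¹  ≡⟨ cong (α⁻¹ ⨾_) (⨾-assoc _ _ _) ⟩
    α⁻¹ ⨾ ((f ⊕₁ g) ⊕₁ h) ⨾ α ⨾ α⁻¹    ≡⟨ cong (λ k → α⁻¹ ⨾ ((f ⊕₁ g) ⊕₁ h) ⨾ k) α-iso₁ ⟩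
    α⁻¹ ⨾ ((f ⊕₁ g) ⊕₁ h) ⨾ id         ≡⟨ cong (α⁻¹ ⨾_) (⨾-idʳ _) ⟩
    α⁻¹ ⨾ ((f ⊕₁ g) ⊕₁ h)              ∎
    where open ≡-Reasoning

  σ₁₂ : ∀ {X Y Z} → Hom (X ⊕ (Y ⊕ Z)) (Y ⊕ (X ⊕ Z))
  σ₁₂ = α⁻¹ ⨾ (σ ⊕₁ id) ⨾ α

  hexagon₂ : ∀ {A B C} → α {A} {B} {C} ⨾ (id ⊕₁ σ) ⨾ σ₁₂ ≡ σ
  hexagon₂ = begin
    P              ≡⟨ sym (cancelˡ σ-inv P) ⟩
    σ ⨾ σ ⨾ P      ≡⟨ cong (σ ⨾_) σ⨾P≡id ⟩
    σ ⨾ id         ≡⟨ ⨾-idʳ σ ⟩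
    σ              ∎
    where
    open ≡-Reasoning
    P = α ⨾ (id ⊕₁ σ) ⨾ σ₁₂
    σ⨾P≡id : σ ⨾ P ≡ id
    σ⨾P≡id = begin
      σ ⨾ α ⨾ (id ⊕₁ σ) ⨾ α⁻¹ ⨾ (σ ⊕₁ id) ⨾ α
        ≡⟨ sym (cancelˡ α-iso₂ _) ⟩
      α⁻¹ ⨾ α ⨾ σ ⨾ α ⨾ (id ⊕₁ σ) ⨾ α⁻¹ ⨾ (σ ⊕₁ id) ⨾ α
        ≡⟨ cong (α⁻¹ ⨾_) (extend₃ hexagon _) ⟩
      α⁻¹ ⨾ (σ ⊕₁ id) ⨾ α ⨾ (id ⊕₁ σ) ⨾ (id ⊕₁ σ) ⨾ α⁻¹ ⨾ (σ ⊕₁ id) ⨾ α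
        ≡⟨ cong (λ k → α⁻¹ ⨾ (σ ⊕₁ id) ⨾ α ⨾ k) (cancelˡ (⊕-inverse (⨾-idˡ id) σ-inv) _) ⟩
      α⁻¹ ⨾ (σ ⊕₁ id) ⨾ α ⨾ α⁻¹ ⨾ (σ ⊕₁ id) ⨾ α
        ≡⟨ cong (λ k → α⁻¹ ⨾ (σ ⊕₁ id) ⨾ k) (cancelˡ α-iso₁ _) ⟩
      α⁻¹ ⨾ (σ ⊕₁ id) ⨾ (σ ⊕₁ id) ⨾ α
        ≡⟨ cong (α⁻¹ ⨾_) (cancelˡ (⊕-inverse σ-inv (⨾-idˡ id)) α) ⟩
      α⁻¹ ⨾ α
        ≡⟨ α-iso₂ ⟩
      id ∎

  hexagon₂-nat : ∀ {Z X A B} (f : Hom A B) →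
                 α {Z} {X} ⨾ (id ⊕₁ ((id ⊕₁ f) ⨾ σ)) ⨾ σ₁₂ ≡ (id ⊕₁ f) ⨾ σ
  hexagon₂-nat f = begin
    α ⨾ (id ⊕₁ ((id ⊕₁ f) ⨾ σ)) ⨾ σ₁₂            ≡⟨ cong (λ k → α ⨾ k ⨾ σ₁₂) (⊕-⨾ʳ id (id ⊕₁ f) σ) ⟩
    α ⨾ ((id ⊕₁ (id ⊕₁ f)) ⨾ (id ⊕₁ σ)) ⨾ σ₁₂    ≡⟨ cong (α ⨾_) (⨾-assoc _ _ _) ⟩
    α ⨾ (id ⊕₁ (id ⊕₁ f)) ⨾ (id ⊕₁ σ) ⨾ σ₁₂      ≡⟨ extend₂ (sym (α-nat id id f)) _ ⟩
    ((id ⊕₁ id) ⊕₁ f) ⨾ α ⨾ (id ⊕₁ σ) ⨾ σ₁₂      ≡⟨ cong₂ _⨾_ (cong (_⊕₁ f) ⊕-id) hexagon₂ ⟩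
    (id ⊕₁ f) ⨾ σ                                ∎
    where open ≡-Reasoning

module Convolution {o ℓ e} {C : SymMonPosetCat o ℓ e} (B : IsFBCIC C) where
  open SymMonPosetCat C
  open IsFBCIC B
  open Monoidal C

  _+_ : ∀ {X Y} → Hom X Y → Hom X Y → Hom X Y
  _+_ {X} {Y} f g = Δ X ⨾ (f ⊕₁ g) ⨾ ∇ Y

  ⊥ : ∀ {X Y} → Hom X Y
  ⊥ {X} {Y} = ! X ⨾ ¡ Y

  ⊥≤f : ∀ {X Y} (f : Hom X Y) → ⊥ ≤ f
  ⊥≤f {X} {Y} f = begin
    ! X ⨾ ¡ Y        ≡⟨ pushˡ (sym (!-hom f)) (¡ Y) ⟩
    f ⨾ ! Y ⨾ ¡ Y    ≤⟨ ⨾-monoʳ (!¡≤id Y) ⟩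
    f ⨾ id           ≡⟨ ⨾-idʳ f ⟩
    f                ∎
    where open ≤-Reasoning

  f+f≤f : ∀ {X Y} (f : Hom X Y) → f + f ≤ f
  f+f≤f {X} {Y} f = begin
    Δ X ⨾ (f ⊕₁ f) ⨾ ∇ Y   ≡⟨ extend₂ (sym (Δ-hom f)) (∇ Y) ⟩
    f ⨾ Δ Y ⨾ ∇ Y          ≤⟨ ⨾-monoʳ (Δ∇≤id Y) ⟩
    f ⨾ id                 ≡⟨ ⨾-idʳ f ⟩
    f                      ∎
    where open ≤-Reasoning

  +-comm : ∀ {X Y} (f g : Hom X Y) → f + g ≡ g + f
  +-comm {X} {Y} f g = begin
    Δ X ⨾ (f ⊕₁ g) ⨾ ∇ Y       ≡⟨ cong (λ k → Δ X ⨾ (f ⊕₁ g) ⨾ k) (sym (∇-comm Y)) ⟩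
    Δ X ⨾ (f ⊕₁ g) ⨾ σ ⨾ ∇ Y   ≡⟨ cong (Δ X ⨾_) (extend₂ (σ-nat f g) (∇ Y)) ⟩
    Δ X ⨾ σ ⨾ (g ⊕₁ f) ⨾ ∇ Y   ≡⟨ pullˡ (Δ-cocomm X) _ ⟩
    Δ X ⨾ (g ⊕₁ f) ⨾ ∇ Y       ∎
    where open ≡-Reasoning

  +-identityʳ : ∀ {X Y} (f : Hom X Y) → f + ⊥ ≡ f
  +-identityʳ {X} {Y} f = begin
    Δ X ⨾ (f ⊕₁ (! X ⨾ ¡ Y)) ⨾ ∇ Y
      ≡⟨ cong (Δ X ⨾_) (pushˡ (⊕-⨾ʳ f (! X) (¡ Y)) (∇ Y)) ⟩
    Δ X ⨾ (id ⊕₁ ! X) ⨾ (f ⊕₁ ¡ Y) ⨾ ∇ Y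
      ≡⟨ pullˡ (Δ-counitʳ X) _ ⟩
    ru⁻¹ ⨾ (f ⊕₁ ¡ Y) ⨾ ∇ Y
      ≡⟨ cong (ru⁻¹ ⨾_) (pushˡ (serialize₁₂ f (¡ Y)) (∇ Y)) ⟩
    ru⁻¹ ⨾ (f ⊕₁ id) ⨾ (id ⊕₁ ¡ Y) ⨾ ∇ Y
      ≡⟨ cong (λ k → ru⁻¹ ⨾ (f ⊕₁ id) ⨾ k) (∇-unitʳ Y) ⟩
    ru⁻¹ ⨾ (f ⊕₁ id) ⨾ ru
      ≡⟨ cong (ru⁻¹ ⨾_) (ru-nat f) ⟩
    ru⁻¹ ⨾ ru ⨾ f
      ≡⟨ cancelˡ ru-iso₂ f ⟩
    f ∎
    where open ≡-Reasoning

  +-identityˡ : ∀ {X Y} (f : Hom X Y) → ⊥ + f ≡ f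
  +-identityˡ f = trans (+-comm ⊥ f) (+-identityʳ f)

  +-mono-≤ : ∀ {X Y} {f f′ g g′ : Hom X Y} → f ≤ f′ → g ≤ g′ → f + g ≤ f′ + g′
  +-mono-≤ p q = ⨾-monoʳ (⨾-monoˡ (⊕-mono p q))

  f≤f+g : ∀ {X Y} (f g : Hom X Y) → f ≤ f + g
  f≤f+g f g = ≤-trans (≤-reflexive (sym (+-identityʳ f))) (+-mono-≤ ≤-refl (⊥≤f g))

  g≤f+g : ∀ {X Y} (f g : Hom X Y) → g ≤ f + g
  g≤f+g f g = ≤-trans (f≤f+g g f) (≤-reflexive (+-comm g f))

  +-least : ∀ {X Y} {f g h : Hom X Y} → f ≤ h → g ≤ h → f + g ≤ h
  +-least p q = ≤-trans (+-mono-≤ p q) (f+f≤f _)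

  +-idem : ∀ {X Y} (f : Hom X Y) → f + f ≡ f
  +-idem f = ≤-antisym (f+f≤f f) (f≤f+g f f)

  +-assoc : ∀ {X Y} (f g h : Hom X Y) → (f + g) + h ≡ f + (g + h)
  +-assoc f g h = ≤-antisym
    (+-least (+-least (f≤f+g f _) (≤-trans (f≤f+g g h) (g≤f+g f _)))
             (≤-trans (g≤f+g g h) (g≤f+g f _)))
    (+-least (≤-trans (f≤f+g f g) (f≤f+g _ h))
             (+-least (≤-trans (g≤f+g f g) (f≤f+g _ h)) (g≤f+g _ h)))

  ≤⇒+≡ : ∀ {X Y} {f g : Hom X Y} → f ≤ g → f + g ≡ g
  ≤⇒+≡ {g = g} p = ≤-antisym (+-least p ≤-refl) (g≤f+g _ g)

  +≡⇒≤ : ∀ {X Y} {f g : Hom X Y} → f + g ≡ g → f ≤ g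
  +≡⇒≤ {f = f} {g} p = ≤-trans (f≤f+g f g) (≤-reflexive p)

  +-⊥-isIdempotentCommutativeMonoid : ∀ {X Y} →
    IsIdempotentCommutativeMonoid (_≡_ {A = Hom X Y}) _+_ ⊥
  +-⊥-isIdempotentCommutativeMonoid = record
    { isCommutativeMonoid = record
      { isMonoid = record
        { isSemigroup = record
          { isMagma = record { isEquivalence = isEquivalence ; ∙-cong = cong₂ _+_ }
          ; assoc = +-assoc
          }
        ; identity = +-identityˡ , +-identityʳ
        }
      ; comm = +-comm
      }
    ; idem = +-idem
    }

  ⨾-distribˡ-+ : ∀ {X Y Z} (f : Hom X Y) (g h : Hom Y Z) → f ⨾ (g + h) ≡ (f ⨾ g) + (f ⨾ h)
  ⨾-distribˡ-+ {X} {Y} {Z} f g h = begin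
    f ⨾ Δ Y ⨾ (g ⊕₁ h) ⨾ ∇ Z            ≡⟨ extend₂ (Δ-hom f) _ ⟩
    Δ X ⨾ (f ⊕₁ f) ⨾ (g ⊕₁ h) ⨾ ∇ Z     ≡⟨ cong (Δ X ⨾_) (pullˡ (⊕-interchange f f g h) (∇ Z)) ⟩
    Δ X ⨾ ((f ⨾ g) ⊕₁ (f ⨾ h)) ⨾ ∇ Z    ∎
    where open ≡-Reasoning

  ⨾-distribʳ-+ : ∀ {X Y Z} (f g : Hom X Y) (h : Hom Y Z) → (f + g) ⨾ h ≡ (f ⨾ h) + (g ⨾ h)
  ⨾-distribʳ-+ {X} {Y} {Z} f g h = begin
    (Δ X ⨾ (f ⊕₁ g) ⨾ ∇ Y) ⨾ h          ≡⟨ assoc³ _ _ _ h ⟩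
    Δ X ⨾ (f ⊕₁ g) ⨾ ∇ Y ⨾ h            ≡⟨ cong (λ k → Δ X ⨾ (f ⊕₁ g) ⨾ k) (∇-hom h) ⟩
    Δ X ⨾ (f ⊕₁ g) ⨾ (h ⊕₁ h) ⨾ ∇ Z     ≡⟨ cong (Δ X ⨾_) (pullˡ (⊕-interchange f g h h) (∇ Z)) ⟩
    Δ X ⨾ ((f ⨾ h) ⊕₁ (g ⨾ h)) ⨾ ∇ Z    ∎
    where open ≡-Reasoning

  ⨾-zeroˡ : ∀ {X Y Z} (f : Hom Y Z) → ⊥ {X} ⨾ f ≡ ⊥
  ⨾-zeroˡ {X} f = trans (⨾-assoc _ _ _) (cong (! X ⨾_) (¡-hom f))

  ⨾-zeroʳ : ∀ {X Y Z} (f : Hom X Y) → f ⨾ ⊥ {Y} {Z} ≡ ⊥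
  ⨾-zeroʳ {Z = Z} f = trans (sym (⨾-assoc _ _ _)) (cong (_⨾ ¡ Z) (!-hom f))

  ∇Δ-natural : ∀ {X Y} (r : Hom X Y) → ∇ X ⨾ Δ X ⨾ (r ⊕₁ r) ≡ (r ⊕₁ r) ⨾ ∇ Y ⨾ Δ Y
  ∇Δ-natural {X} {Y} r = begin
    ∇ X ⨾ Δ X ⨾ (r ⊕₁ r)    ≡⟨ cong (∇ X ⨾_) (sym (Δ-hom r)) ⟩
    ∇ X ⨾ r ⨾ Δ Y           ≡⟨ extend₂ (∇-hom r) (Δ Y) ⟩
    (r ⊕₁ r) ⨾ ∇ Y ⨾ Δ Y    ∎
    where open ≡-Reasoning

  ∇⊕id-natural : ∀ {X Y Z} (f : Hom X Y) →
                 ((f ⊕₁ f) ⊕₁ id {Z}) ⨾ (∇ Y ⊕₁ id) ≡ (∇ X ⊕₁ id) ⨾ (f ⊕₁ id)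
  ∇⊕id-natural {X} {Y} f = begin
    ((f ⊕₁ f) ⊕₁ id) ⨾ (∇ Y ⊕₁ id)   ≡⟨ ⊕-interchange _ _ _ _ ⟩
    ((f ⊕₁ f) ⨾ ∇ Y) ⊕₁ (id ⨾ id)    ≡⟨ cong (_⊕₁ (id ⨾ id)) (sym (∇-hom f)) ⟩
    (∇ X ⨾ f) ⊕₁ (id ⨾ id)           ≡⟨ ⊕-⨾ _ _ _ _ ⟩
    (∇ X ⊕₁ id) ⨾ (f ⊕₁ id)          ∎
    where open ≡-Reasoning

  Δ-coassoc⁻¹ : ∀ X → Δ X ⨾ (id ⊕₁ Δ X) ⨾ α⁻¹ ≡ Δ X ⨾ (Δ X ⊕₁ id)
  Δ-coassoc⁻¹ X = begin
    Δ X ⨾ (id ⊕₁ Δ X) ⨾ α⁻¹        ≡⟨ pullˡ (sym (Δ-coassoc X)) α⁻¹ ⟩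
    (Δ X ⨾ (Δ X ⊕₁ id) ⨾ α) ⨾ α⁻¹  ≡⟨ assoc³ _ _ _ _ ⟩
    Δ X ⨾ (Δ X ⊕₁ id) ⨾ α ⨾ α⁻¹    ≡⟨ cong (λ k → Δ X ⨾ (Δ X ⊕₁ id) ⨾ k) α-iso₁ ⟩
    Δ X ⨾ (Δ X ⊕₁ id) ⨾ id         ≡⟨ cong (Δ X ⨾_) (⨾-idʳ _) ⟩
    Δ X ⨾ (Δ X ⊕₁ id)              ∎
    where open ≡-Reasoning

  frobenius-≤ : ∀ X → (id ⊕₁ Δ X) ⨾ α⁻¹ ⨾ (∇ X ⊕₁ id) ≤ ∇ X ⨾ Δ X
  frobenius-≤ X = begin
    (id ⊕₁ Δ X) ⨾ α⁻¹ ⨾ (∇ X ⊕₁ id)             ≡⟨ sym (⨾-idˡ _) ⟩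
    id ⨾ (id ⊕₁ Δ X) ⨾ α⁻¹ ⨾ (∇ X ⊕₁ id)        ≤⟨ ⨾-monoˡ (id≤∇Δ X) ⟩
    (∇ X ⨾ Δ X) ⨾ (id ⊕₁ Δ X) ⨾ α⁻¹ ⨾ (∇ X ⊕₁ id)
                                               ≡⟨ ⨾-assoc _ _ _ ⟩
    ∇ X ⨾ Δ X ⨾ (id ⊕₁ Δ X) ⨾ α⁻¹ ⨾ (∇ X ⊕₁ id) ≡⟨ cong (∇ X ⨾_) (pull₃ (Δ-coassoc⁻¹ X) (∇ X ⊕₁ id)) ⟩
    ∇ X ⨾ (Δ X ⨾ (Δ X ⊕₁ id)) ⨾ (∇ X ⊕₁ id)     ≡⟨ cong (∇ X ⨾_) (⨾-assoc _ _ _) ⟩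
    ∇ X ⨾ Δ X ⨾ (Δ X ⊕₁ id) ⨾ (∇ X ⊕₁ id)       ≡⟨ cong (λ k → ∇ X ⨾ Δ X ⨾ k) (⊕-interchange _ _ _ _) ⟩
    ∇ X ⨾ Δ X ⨾ ((Δ X ⨾ ∇ X) ⊕₁ (id ⨾ id))      ≤⟨ ⨾-monoʳ (⨾-monoʳ (⊕-mono (Δ∇≤id X) (≤-reflexive (⨾-idˡ id)))) ⟩
    ∇ X ⨾ Δ X ⨾ (id ⊕₁ id)                      ≡⟨ cong (λ k → ∇ X ⨾ Δ X ⨾ k) ⊕-id ⟩
    ∇ X ⨾ Δ X ⨾ id                              ≡⟨ cong (∇ X ⨾_) (⨾-idʳ (Δ X)) ⟩
    ∇ X ⨾ Δ X                                   ∎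
    where open ≤-Reasoning

module KleeneStar {o ℓ e} (K : KleeneBicategory o ℓ e) where
  open KleeneBicategory K hiding (_+_; ⊥)
  open Monoidal cat
  open Convolution fbc

  loop : ∀ {X} → Hom X X → Hom (X ⊕ X) (X ⊕ X)
  loop {X} f = ∇ X ⨾ Δ X ⨾ (f ⊕₁ id)

  tr-⨾ˡ : ∀ {S X X′ Y} (f : Hom X′ X) (h : Hom (S ⊕ X) (S ⊕ Y)) →
          tr ((id ⊕₁ f) ⨾ h) ≡ f ⨾ tr h
  tr-⨾ˡ f h = begin
    tr ((id ⊕₁ f) ⨾ h)                 ≡⟨ cong (λ k → tr ((id ⊕₁ f) ⨾ k)) (sym (⨾-idʳ′ h)) ⟩
    tr ((id ⊕₁ f) ⨾ h ⨾ (id ⊕₁ id))    ≡⟨ tightening f h id ⟩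
    f ⨾ tr h ⨾ id                      ≡⟨ cong (f ⨾_) (⨾-idʳ (tr h)) ⟩
    f ⨾ tr h                           ∎
    where open ≡-Reasoning

  tr-⨾ʳ : ∀ {S X Y Y′} (h : Hom (S ⊕ X) (S ⊕ Y)) (g : Hom Y Y′) →
          tr (h ⨾ (id ⊕₁ g)) ≡ tr h ⨾ g
  tr-⨾ʳ h g = begin
    tr (h ⨾ (id ⊕₁ g))                 ≡⟨ cong tr (sym (⨾-idˡ′ _)) ⟩
    tr ((id ⊕₁ id) ⨾ h ⨾ (id ⊕₁ g))    ≡⟨ tightening id h g ⟩
    id ⨾ tr h ⨾ g                      ≡⟨ ⨾-idˡ _ ⟩
    tr h ⨾ g                           ∎
    where open ≡-Reasoning

  tr-σ₁₂ : ∀ {X Y} → tr {X} (σ₁₂ {X} {X} {Y}) ≡ id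
  tr-σ₁₂ = trans (strength σ id) (trans (cong (_⊕₁ id) yanking) ⊕-id)

  ⨾-as-tr : ∀ {X A B C} (a : Hom A (X ⊕ B)) (b : Hom (X ⊕ B) C) →
            a ⨾ b ≡ tr {X} ((id ⊕₁ a) ⨾ σ₁₂ ⨾ (id ⊕₁ b))
  ⨾-as-tr a b = begin
    a ⨾ b                                 ≡⟨ cong (a ⨾_) (sym (⨾-idˡ b)) ⟩
    a ⨾ id ⨾ b                            ≡⟨ cong (λ k → a ⨾ k ⨾ b) (sym tr-σ₁₂) ⟩
    a ⨾ tr σ₁₂ ⨾ b                        ≡⟨ sym (tightening a σ₁₂ b) ⟩
    tr ((id ⊕₁ a) ⨾ σ₁₂ ⨾ (id ⊕₁ b))      ∎
    where open ≡-Reasoning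

  id≤f* : ∀ {X} (f : Hom X X) → id ≤ f *
  id≤f* {X} f = begin
    id                  ≡⟨ sym lu-iso₂ ⟩
    lu⁻¹ ⨾ lu           ≡⟨ cong (lu⁻¹ ⨾_) (sym (⨾-idˡ lu)) ⟩
    lu⁻¹ ⨾ id ⨾ lu      ≡⟨ sym (vanishing id) ⟩
    tr {𝟘} id           ≤⟨ AU1 id (loop f) (¡ X) simulation ⟩
    tr (loop f)         ∎
    where
    open ≤-Reasoning
    simulation : id ⨾ (¡ X ⊕₁ id) ≤ (¡ X ⊕₁ id) ⨾ loop f
    simulation = begin
      id ⨾ (¡ X ⊕₁ id)                      ≡⟨ ⨾-idˡ _ ⟩
      ¡ X ⊕₁ id                             ≡⟨ sym (cancelˡ lu-iso₁ _) ⟩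
      lu ⨾ lu⁻¹ ⨾ (¡ X ⊕₁ id)               ≡⟨ cong (lu ⨾_) (pushˡ (sym (Δ-counitˡ X)) _) ⟩
      lu ⨾ Δ X ⨾ (! X ⊕₁ id) ⨾ (¡ X ⊕₁ id)  ≡⟨ cong (λ k → lu ⨾ Δ X ⨾ k) (⊕-interchange _ _ _ _) ⟩
      lu ⨾ Δ X ⨾ ((! X ⨾ ¡ X) ⊕₁ (id ⨾ id)) ≤⟨ ⨾-monoʳ (⨾-monoʳ (⊕-mono (⊥≤f f) (≤-reflexive (⨾-idˡ id)))) ⟩
      lu ⨾ Δ X ⨾ (f ⊕₁ id)                  ≡⟨ pushˡ (sym (∇-unitˡ X)) _ ⟩
      (¡ X ⊕₁ id) ⨾ loop f                  ∎

  f⨾f*≡f*⨾f : ∀ {X} (f : Hom X X) → f ⨾ f * ≡ f * ⨾ f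
  f⨾f*≡f*⨾f {X} f = begin
    f ⨾ tr (loop f)                            ≡⟨ sym (tr-⨾ˡ f (loop f)) ⟩
    tr ((id ⊕₁ f) ⨾ ∇ X ⨾ Δ X ⨾ (f ⊕₁ id))     ≡⟨ cong tr (sym (assoc³ _ _ _ _)) ⟩
    tr (((id ⊕₁ f) ⨾ ∇ X ⨾ Δ X) ⨾ (f ⊕₁ id))   ≡⟨ sliding _ f ⟩
    tr ((f ⊕₁ id) ⨾ (id ⊕₁ f) ⨾ ∇ X ⨾ Δ X)     ≡⟨ cong tr (pullˡ (sym (serialize₁₂ f f)) _) ⟩
    tr ((f ⊕₁ f) ⨾ ∇ X ⨾ Δ X)                  ≡⟨ cong tr (sym (∇Δ-natural f)) ⟩
    tr (∇ X ⨾ Δ X ⨾ (f ⊕₁ f))                  ≡⟨ cong (λ k → tr (∇ X ⨾ Δ X ⨾ k)) (serialize₁₂ f f) ⟩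
    tr (∇ X ⨾ Δ X ⨾ (f ⊕₁ id) ⨾ (id ⊕₁ f))     ≡⟨ cong tr (sym (assoc³ _ _ _ _)) ⟩
    tr (loop f ⨾ (id ⊕₁ f))                    ≡⟨ tr-⨾ʳ (loop f) f ⟩
    tr (loop f) ⨾ f                            ∎
    where open ≡-Reasoning

  -- The delayed system keeps the state of loop f split as a pair (t , s); ∇ merges it into t + s.
  delayed-loop-simulation : ∀ {X} (f : Hom X X) →
    ((id ⊕₁ f) ⨾ σ ⨾ (id ⊕₁ loop f) ⨾ α⁻¹) ⨾ (∇ X ⊕₁ id) ≤ (∇ X ⊕₁ id) ⨾ loop f
  delayed-loop-simulation {X} f = begin
    ((id ⊕₁ f) ⨾ σ ⨾ (id ⊕₁ loop f) ⨾ α⁻¹) ⨾ (∇ X ⊕₁ id)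
      ≡⟨ trans (⨾-assoc _ _ _) (cong ((id ⊕₁ f) ⨾_) (assoc³ _ _ _ _)) ⟩
    (id ⊕₁ f) ⨾ σ ⨾ (id ⊕₁ loop f) ⨾ α⁻¹ ⨾ (∇ X ⊕₁ id)
      ≡⟨ extend₂ (σ-nat id f) _ ⟩
    σ ⨾ (f ⊕₁ id) ⨾ (id ⊕₁ loop f) ⨾ α⁻¹ ⨾ (∇ X ⊕₁ id)
      ≡⟨ cong (σ ⨾_) (pullˡ (sym (serialize₁₂ f (loop f))) _) ⟩
    σ ⨾ (f ⊕₁ loop f) ⨾ α⁻¹ ⨾ (∇ X ⊕₁ id)
      ≡⟨ cong (σ ⨾_) (pushˡ (⊕-⨾ʳ f (∇ X) _) _) ⟩
    σ ⨾ (id ⊕₁ ∇ X) ⨾ (f ⊕₁ (Δ X ⨾ (f ⊕₁ id))) ⨾ α⁻¹ ⨾ (∇ X ⊕₁ id)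
      ≡⟨ cong (λ k → σ ⨾ (id ⊕₁ ∇ X) ⨾ k) (pushˡ (⊕-⨾ʳ f (Δ X) _) _) ⟩
    σ ⨾ (id ⊕₁ ∇ X) ⨾ (id ⊕₁ Δ X) ⨾ (f ⊕₁ (f ⊕₁ id)) ⨾ α⁻¹ ⨾ (∇ X ⊕₁ id)
      ≡⟨ cong (λ k → σ ⨾ (id ⊕₁ ∇ X) ⨾ (id ⊕₁ Δ X) ⨾ k) (extend₂ (α⁻¹-nat f f id) _) ⟩
    σ ⨾ (id ⊕₁ ∇ X) ⨾ (id ⊕₁ Δ X) ⨾ α⁻¹ ⨾ ((f ⊕₁ f) ⊕₁ id) ⨾ (∇ X ⊕₁ id)
      ≡⟨ cong (λ k → σ ⨾ (id ⊕₁ ∇ X) ⨾ (id ⊕₁ Δ X) ⨾ α⁻¹ ⨾ k) (∇⊕id-natural f) ⟩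
    σ ⨾ (id ⊕₁ ∇ X) ⨾ (id ⊕₁ Δ X) ⨾ α⁻¹ ⨾ (∇ X ⊕₁ id) ⨾ (f ⊕₁ id)
      ≡⟨ cong (λ k → σ ⨾ (id ⊕₁ ∇ X) ⨾ k) (sym (assoc³ _ _ _ _)) ⟩
    σ ⨾ (id ⊕₁ ∇ X) ⨾ ((id ⊕₁ Δ X) ⨾ α⁻¹ ⨾ (∇ X ⊕₁ id)) ⨾ (f ⊕₁ id)
      ≤⟨ ⨾-monoʳ (⨾-monoʳ (⨾-monoˡ (frobenius-≤ X))) ⟩
    σ ⨾ (id ⊕₁ ∇ X) ⨾ (∇ X ⨾ Δ X) ⨾ (f ⊕₁ id)
      ≡⟨ cong (λ k → σ ⨾ (id ⊕₁ ∇ X) ⨾ k) (⨾-assoc _ _ _) ⟩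
    σ ⨾ (id ⊕₁ ∇ X) ⨾ loop f
      ≡⟨ extend₂ (sym (σ-nat (∇ X) id)) _ ⟩
    (∇ X ⊕₁ id) ⨾ σ ⨾ loop f
      ≡⟨ cong ((∇ X ⊕₁ id) ⨾_) (pullˡ (∇-comm X) _) ⟩
    (∇ X ⊕₁ id) ⨾ loop f ∎
    where open ≤-Reasoning

  f⨾f*≤f* : ∀ {X} (f : Hom X X) → f ⨾ f * ≤ f *
  f⨾f*≤f* {X} f = begin
    f ⨾ tr (loop f)                            ≡⟨ sym (tr-⨾ˡ f (loop f)) ⟩
    tr ((id ⊕₁ f) ⨾ loop f)                    ≡⟨ cong (λ k → tr ((id ⊕₁ f) ⨾ k)) (sym (pullˡ (∇-comm X) _)) ⟩
    tr ((id ⊕₁ f) ⨾ σ ⨾ loop f)                ≡⟨ cong tr (sym (⨾-assoc _ _ _)) ⟩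
    tr (c ⨾ loop f)                            ≡⟨ cong tr (⨾-as-tr c (loop f)) ⟩
    tr (tr ((id ⊕₁ c) ⨾ σ₁₂ ⨾ (id ⊕₁ loop f))) ≡⟨ joining _ ⟩
    tr (α ⨾ ((id ⊕₁ c) ⨾ σ₁₂ ⨾ (id ⊕₁ loop f)) ⨾ α⁻¹)
                                               ≡⟨ cong tr (cong (α ⨾_) (assoc³ _ _ _ _)) ⟩
    tr (α ⨾ (id ⊕₁ c) ⨾ σ₁₂ ⨾ (id ⊕₁ loop f) ⨾ α⁻¹)
                                               ≡⟨ cong tr (pull₃ (hexagon₂-nat f) _) ⟩
    tr (((id ⊕₁ f) ⨾ σ) ⨾ (id ⊕₁ loop f) ⨾ α⁻¹) ≡⟨ cong tr (⨾-assoc _ _ _) ⟩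
    tr ((id ⊕₁ f) ⨾ σ ⨾ (id ⊕₁ loop f) ⨾ α⁻¹)  ≤⟨ AU1 _ (loop f) (∇ X) (delayed-loop-simulation f) ⟩
    tr (loop f)                                ∎
    where
    open ≤-Reasoning
    c : Hom (X ⊕ X) (X ⊕ X)
    c = (id ⊕₁ f) ⨾ σ

  f*⨾f≤f* : ∀ {X} (f : Hom X X) → f * ⨾ f ≤ f *
  f*⨾f≤f* f = ≤-trans (≤-reflexive (sym (f⨾f*≡f*⨾f f))) (f⨾f*≤f* f)

  *-indˡ : ∀ {X Y} (f : Hom X X) (r : Hom X Y) → f ⨾ r ≤ r → f * ⨾ r ≤ r
  *-indˡ {X} {Y} f r p = begin
    tr (loop f) ⨾ r                   ≡⟨ sym (tr-⨾ʳ (loop f) r) ⟩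
    tr (loop f ⨾ (id ⊕₁ r))           ≤⟨ AU1 _ _ r simulation ⟩
    tr ((id ⊕₁ r) ⨾ ∇ Y ⨾ Δ Y)        ≡⟨ tr-⨾ˡ r (∇ Y ⨾ Δ Y) ⟩
    r ⨾ tr (∇ Y ⨾ Δ Y)                ≤⟨ ⨾-monoʳ (AT1 Y) ⟩
    r ⨾ id                            ≡⟨ ⨾-idʳ r ⟩
    r                                 ∎
    where
    open ≤-Reasoning
    simulation : (loop f ⨾ (id ⊕₁ r)) ⨾ (r ⊕₁ id) ≤ (r ⊕₁ id) ⨾ (id ⊕₁ r) ⨾ ∇ Y ⨾ Δ Y
    simulation = begin
      (loop f ⨾ (id ⊕₁ r)) ⨾ (r ⊕₁ id)   ≡⟨ ⨾-assoc _ _ _ ⟩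
      loop f ⨾ (id ⊕₁ r) ⨾ (r ⊕₁ id)     ≡⟨ cong (loop f ⨾_) (sym (serialize₂₁ r r)) ⟩
      loop f ⨾ (r ⊕₁ r)                  ≡⟨ assoc³ _ _ _ _ ⟩
      ∇ X ⨾ Δ X ⨾ (f ⊕₁ id) ⨾ (r ⊕₁ r)   ≡⟨ cong (λ k → ∇ X ⨾ Δ X ⨾ k) (⊕-interchange f id r r) ⟩
      ∇ X ⨾ Δ X ⨾ ((f ⨾ r) ⊕₁ (id ⨾ r))  ≤⟨ ⨾-monoʳ (⨾-monoʳ (⊕-mono p (≤-reflexive (⨾-idˡ r)))) ⟩
      ∇ X ⨾ Δ X ⨾ (r ⊕₁ r)               ≡⟨ ∇Δ-natural r ⟩
      (r ⊕₁ r) ⨾ ∇ Y ⨾ Δ Y               ≡⟨ pushˡ (serialize₁₂ r r) _ ⟩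
      (r ⊕₁ id) ⨾ (id ⊕₁ r) ⨾ ∇ Y ⨾ Δ Y  ∎

  *-indʳ : ∀ {X Y} (f : Hom Y Y) (l : Hom X Y) → l ⨾ f ≤ l → l ⨾ f * ≤ l
  *-indʳ {X} {Y} f l p = begin
    l ⨾ tr (loop f)                   ≡⟨ sym (tr-⨾ˡ l (loop f)) ⟩
    tr ((id ⊕₁ l) ⨾ loop f)           ≤⟨ AU2 _ _ l simulation ⟩
    tr ((∇ X ⨾ Δ X) ⨾ (id ⊕₁ l))      ≡⟨ tr-⨾ʳ (∇ X ⨾ Δ X) l ⟩
    tr (∇ X ⨾ Δ X) ⨾ l                ≤⟨ ⨾-monoˡ (AT1 X) ⟩
    id ⨾ l                            ≡⟨ ⨾-idˡ l ⟩
    l                                 ∎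
    where
    open ≤-Reasoning
    simulation : (l ⊕₁ id) ⨾ (id ⊕₁ l) ⨾ loop f ≤ ((∇ X ⨾ Δ X) ⨾ (id ⊕₁ l)) ⨾ (l ⊕₁ id)
    simulation = begin
      (l ⊕₁ id) ⨾ (id ⊕₁ l) ⨾ loop f        ≡⟨ pullˡ (sym (serialize₁₂ l l)) _ ⟩
      (l ⊕₁ l) ⨾ ∇ Y ⨾ Δ Y ⨾ (f ⊕₁ id)      ≡⟨ extend₃ (sym (∇Δ-natural l)) _ ⟩
      ∇ X ⨾ Δ X ⨾ (l ⊕₁ l) ⨾ (f ⊕₁ id)      ≡⟨ cong (λ k → ∇ X ⨾ Δ X ⨾ k) (⊕-interchange l l f id) ⟩
      ∇ X ⨾ Δ X ⨾ ((l ⨾ f) ⊕₁ (l ⨾ id))     ≤⟨ ⨾-monoʳ (⨾-monoʳ (⊕-mono p (≤-reflexive (⨾-idʳ l)))) ⟩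
      ∇ X ⨾ Δ X ⨾ (l ⊕₁ l)                  ≡⟨ cong (λ k → ∇ X ⨾ Δ X ⨾ k) (serialize₂₁ l l) ⟩
      ∇ X ⨾ Δ X ⨾ (id ⊕₁ l) ⨾ (l ⊕₁ id)     ≡⟨ sym (trans (⨾-assoc _ _ _) (⨾-assoc _ _ _)) ⟩
      ((∇ X ⨾ Δ X) ⨾ (id ⊕₁ l)) ⨾ (l ⊕₁ id) ∎

  isTypedKleeneAlgebra : IsTypedKleeneAlgebra Hom id _⨾_ _+_ ⊥ _*
  isTypedKleeneAlgebra = record
    { joinSemilattice = +-⊥-isIdempotentCommutativeMonoid
    ; ⨾-distribˡ-+ = ⨾-distribˡ-+
    ; ⨾-distribʳ-+ = ⨾-distribʳ-+
    ; ⨾-zeroˡ = ⨾-zeroˡ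
    ; ⨾-zeroʳ = ⨾-zeroʳ
    ; star-unfoldˡ = λ f → ≤⇒+≡ (+-least (id≤f* f) (f⨾f*≤f* f))
    ; star-unfoldʳ = λ f → ≤⇒+≡ (+-least (id≤f* f) (f*⨾f≤f* f))
    ; star-indˡ = λ f r p → ≤⇒+≡ (*-indˡ f r (+≡⇒≤ p))
    ; star-indʳ = λ f l p → ≤⇒+≡ (*-indʳ f l (+≡⇒≤ p))
    }

corollary6p8 : ∀ {o ℓ e} (K : KleeneBicategory o ℓ e) →
    IsTypedKleeneAlgebra (KleeneBicategory.Hom K) (KleeneBicategory.id K)
      (KleeneBicategory._⨾_ K) (KleeneBicategory._+_ K)
      (KleeneBicategory.⊥ K) (KleeneBicategory._* K)
corollary6p8 K = KleeneStar.isTypedKleeneAlgebra K
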